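{- Let $n\ge4$. (i) Among all polyphenyl hexagonal chains with $n$ hexagons, $\overline{G}_n$ has the minimum (resp. second minimal, resp. third minimal) Wiener index if and only if its hexagonal squeeze $G_n$ has the minimum (resp. second minimal, resp. third minimal) Wiener index among all spiro hexagonal chains with $n$ hexagons. (ii) Among all polyphenyl hexagonal chains with $n$ hexagons, $\overline{G}_n$ has the maximum (resp. second maximal, resp. third maximal) Wiener index if and only if its hexagonal squeeze $G_n$ has the maximum (resp. second maximal, resp. third maximal) Wiener index among all spiro hexagonal chains with $n$ hexagons.
   Context: The Wiener index is $W(G)=\sum_{\{u,v\}\subseteq V(G)} d(u,v)$, with $d$ the shortest-path distance. A polyphenyl hexagonal chain with $n$ hexagons is a graph consisting of pairwise vertex-disjoint hexagons (6-cycles) $\overline{H}_0,\dots,\overline{H}_{n-1}$ together with, for each $1\le k\le n-1$, one cut-edge joining a vertex $c_k$ of $\overline{H}_k$ to a vertex $t_k$ of $\overline{H}_{k-1}$, where $t_k\ne c_{k-1}$ for $k\ge2$. A spiro hexagonal chain with $n$ hexagons is a union of hexagons $H_0,\dots,H_{n-1}$ where $H_{k-1}$ and $H_k$ share exactly one vertex ($1\le k\le n-1$), these shared vertices are distinct, and non-consecutive hexagons are disjoint. The hexagonal squeeze of a polyphenyl hexagonal chain is the spiro hexagonal chain obtained by contracting each cut-edge $c_kt_k$ to a single vertex; this gives a bijection between (isomorphism classes of) polyphenyl and spiro hexagonal chains with $n$ hexagons. Chains are considered up to isomorphism. -}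

module Defs where

open import Data.Nat using (ℕ; zero; suc; _+_; _*_; _∸_; _<_; _≡ᵇ_)
open import Data.Bool using (Bool; true; false; _∧_; _∨_; if_then_else_)
open import Data.Bool.ListAction using (any)
open import Data.Nat.ListAction using (sum)
open import Data.List using (List; []; _∷_; map; upTo; concatMap; length; _++_)
open import Data.List.Membership.Propositional using (_∈_)
open import Data.List.Relation.Unary.Unique.Propositional using (Unique)
open import Data.Vec using (Vec; []; _∷_)
open import Data.Fin using (Fin; toℕ)
open import Data.Product using (_×_; _,_; proj₁; proj₂; Σ; ∃)
open import Relation.Binary.PropositionalEquality using (_≡_)

-- Finite simple graphs on vertex set {0, …, size-1}, given by an edge list.

record Graph : Set where
  field
    size  : ℕ
    edges : List (ℕ × ℕ)
open Graph public

adj : Graph → ℕ → ℕ → Bool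
adj G u v = any (λ e → ((proj₁ e ≡ᵇ u) ∧ (proj₂ e ≡ᵇ v)) ∨ ((proj₁ e ≡ᵇ v) ∧ (proj₂ e ≡ᵇ u))) (edges G)

reach : Graph → ℕ → ℕ → ℕ → Bool
reach G zero    u v = u ≡ᵇ v
reach G (suc k) u v = reach G k u v ∨ any (λ w → adj G u w ∧ reach G k w v) (upTo (size G))

search : (ℕ → Bool) → ℕ → ℕ → ℕ
search p zero     s = s
search p (suc f)  s = if p s then s else search p f (suc s)

-- shortest-path distance d(u,v): least k with a walk of length ≤ k
-- (for connected graphs on size vertices this is < size, so is found)
dist : Graph → ℕ → ℕ → ℕ
dist G u v = search (λ k → reach G k u v) (size G) 0

wiener : Graph → ℕ
wiener G = sum (map (λ v → sum (map (λ u → dist G u v) (upTo v))) (upTo (size G)))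

-- Hexagon k has its vertices labelled 0..5 cyclically.  The code gives,
-- for k = 1..n-1, a position a_k ∈ {1,…,5} in hexagon k-1:
--  * polyphenyl: cut edge joins c_k = vertex 0 of hexagon k to
--    t_k = vertex a_k of hexagon k-1  (a_k ≠ 0 encodes t_k ≠ c_{k-1});
--  * spiro: vertex 0 of hexagon k is identified with vertex a_k of
--    hexagon k-1 (a_k ≠ 0 encodes distinctness of shared vertices).
-- Every chain is isomorphic to an encoded one and vice versa; the
-- hexagonal squeeze of the polyphenyl chain with code c is the spiro
-- chain with the same code c.

Code : ℕ → Set
Code n = Vec (Fin 5) (n ∸ 1)

-- att c j = a_{j+1}
att : ∀ {m} → Vec (Fin 5) m → ℕ → ℕ
att []       _       = 0
att (x ∷ xs) zero    = suc (toℕ x)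
att (x ∷ xs) (suc j) = att xs j

hexEdges : ℕ → (ℕ → ℕ → ℕ) → List (ℕ × ℕ)
hexEdges n f = concatMap (λ k →
  (f k 0 , f k 1) ∷ (f k 1 , f k 2) ∷ (f k 2 , f k 3) ∷
  (f k 3 , f k 4) ∷ (f k 4 , f k 5) ∷ (f k 5 , f k 0) ∷ []) (upTo n)

polyIdx : ℕ → ℕ → ℕ
polyIdx k i = 6 * k + i

polyphenyl : (n : ℕ) → Code n → Graph
polyphenyl n c = record
  { size  = 6 * n
  ; edges = hexEdges n polyIdx
            ++ map (λ j → (polyIdx (suc j) 0 , polyIdx j (att c j))) (upTo (n ∸ 1)) }

-- spiro: vertex 0 of hexagon 0 is 0, vertex i ≥ 1 of hexagon k is 5k+i,
-- vertex 0 of hexagon k+1 is the shared vertex a_{k+1} of hexagon k.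
spiroIdx : ∀ {m} → Vec (Fin 5) m → ℕ → ℕ → ℕ
spiroIdx c zero    zero    = 0
spiroIdx c (suc k) zero    = 5 * k + att c k
spiroIdx c k       (suc i) = 5 * k + suc i

spiro : (n : ℕ) → Code n → Graph
spiro n c = record
  { size  = 5 * n + 1
  ; edges = hexEdges n (spiroIdx c) }

-- KthMin k f a : exactly k distinct values of f are smaller than f a
-- (k = 0: minimum, k = 1: second minimal, k = 2: third minimal).

KthMin : {A : Set} → ℕ → (A → ℕ) → A → Set
KthMin {A} k f a = Σ (List ℕ) λ vs → Unique vs × length vs ≡ k ×
  (∀ v → v ∈ vs → Σ A λ b → f b ≡ v × v < f a) ×
  (∀ b → f b < f a → f b ∈ vs)

KthMax : {A : Set} → ℕ → (A → ℕ) → A → Set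
KthMax {A} k f a = Σ (List ℕ) λ vs → Unique vs × length vs ≡ k ×
  (∀ v → v ∈ vs → Σ A λ b → f b ≡ v × f a < v) ×
  (∀ b → f a < f b → f b ∈ vs)

-- Both Wiener indices are affine functions of one and the same quantity of the chain.
-- Hexagon m is entered at its vertex 0 and left towards hexagon m + 1 at its attachment
-- vertex a m, through a cut edge of length 1 (polyphenyl) or a shared vertex (spiro). A
-- shortest path between hexagons l < k therefore runs inside hexagon l to a l, across the
-- links, through every hexagon in between from 0 to a m, and inside hexagon k. Summing over
-- all pairs, the sums over the vertices of a hexagon collapse because every vertex of a
-- hexagon has total distance 9 to the others, leaving
--   W(polyphenyl) = P n + 36 T   and   W(spiro) = Q n + 25 T,
-- where T adds up d(0, a m) over all triples l < m < k. Strictly increasing affine images of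
-- T rank the codes in the same way, so the k-th smallest (largest) values correspond.

module Submission where

open import Defs
open import Data.Nat using (ℕ; zero; suc; _+_; _*_; _∸_; _≤_; _<_; _⊓_; ∣_-_∣; _≡ᵇ_; z≤n; s≤s; NonZero)
open import Data.Nat.Properties
open import Data.Nat.GeneralisedArithmetic using (iterate)
open import Data.Nat.ListAction using (sum)
open import Data.Nat.DivMod
  using (_/_; _%_; /-congˡ; m*n/n≡m; m<n⇒m/n≡0; +-distrib-/-∣ˡ; %-remove-+ˡ; m<n⇒m%n≡m; m%n<n)
open import Data.Nat.Divisibility using (m∣m*n)
open import Data.Nat.Tactic.RingSolver using (solve-∀)
open import Algebra.Properties.CommutativeSemigroup +-commutativeSemigroup
  using () renaming (interchange to +-interchange)
open import Data.Bool using (Bool; true; false; T; _∧_)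
open import Data.Bool.Properties using (T-∧; T-∨)
open import Data.List.Relation.Unary.Any using (here; there)
open import Data.List.Relation.Unary.Any.Properties using (any⁺; any⁻)
open import Data.List.Membership.Propositional using (_∈_; find; lose)
open import Data.List.Membership.Propositional.Properties
  using (∈-upTo⁺; ∈-upTo⁻; ∈-concatMap⁺; ∈-concatMap⁻; ∈-++⁺ˡ; ∈-++⁺ʳ; ∈-++⁻; ∈-map⁺; ∈-map⁻)
open import Relation.Nullary using (¬_; contradiction)
open import Data.Fin using (Fin; toℕ; fromℕ<)
open import Data.Fin.Properties using (all?; toℕ-fromℕ<; toℕ<n)
open import Data.Vec using (Vec; []; _∷_)
open import Data.List using (List; []; _∷_; upTo; applyUpTo; map; length)
open import Data.List.Properties using (map-upTo; length-map)
import Data.List.Relation.Unary.All as All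
open import Data.List.Relation.Unary.All.Properties using () renaming (map⁺ to All-map⁺)
open import Data.List.Relation.Unary.AllPairs using ([]; _∷_)
open import Data.List.Relation.Unary.Unique.Propositional using (Unique)
open import Data.Product using (_×_; _,_; proj₁; proj₂; Σ)
open import Data.Sum using (_⊎_; inj₁; inj₂; swap)
open import Function using (_∘_; _⇔_; mk⇔; Equivalence)
open import Relation.Nullary.Decidable using (True; toWitness; _×-dec_; _⊎-dec_)
open import Relation.Unary using (Decidable)
open import Relation.Binary.Definitions using () renaming (Decidable to Decidable₂)
open import Relation.Binary.PropositionalEquality

∑ : ℕ → (ℕ → ℕ) → ℕ
∑ zero    f = 0
∑ (suc n) f = f 0 + ∑ n (f ∘ suc)

syntax ∑ n (λ i → e) = ∑[ i < n ] e

sum-upTo : ∀ (f : ℕ → ℕ) n → sum (map f (upTo n)) ≡ ∑ n f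
sum-upTo f n = trans (cong sum (map-upTo f n)) (sum-applyUpTo f n)
  where
  sum-applyUpTo : ∀ (f : ℕ → ℕ) n → sum (applyUpTo f n) ≡ ∑ n f
  sum-applyUpTo f zero    = refl
  sum-applyUpTo f (suc n) = cong (f 0 +_) (sum-applyUpTo (f ∘ suc) n)

∑-cong : ∀ {f g} n → (∀ i → i < n → f i ≡ g i) → ∑ n f ≡ ∑ n g
∑-cong zero    eq = refl
∑-cong (suc n) eq = cong₂ _+_ (eq 0 (s≤s z≤n)) (∑-cong n (λ i i<n → eq (suc i) (s≤s i<n)))

∑-+ : ∀ n f g → ∑[ i < n ] (f i + g i) ≡ ∑ n f + ∑ n g
∑-+ zero    f g = refl
∑-+ (suc n) f g =
  trans (cong (f 0 + g 0 +_) (∑-+ n (f ∘ suc) (g ∘ suc))) (+-interchange (f 0) (g 0) _ _)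

∑-*ˡ : ∀ n c f → ∑[ i < n ] (c * f i) ≡ c * ∑ n f
∑-*ˡ zero    c f = sym (*-zeroʳ c)
∑-*ˡ (suc n) c f = trans (cong (c * f 0 +_) (∑-*ˡ n c (f ∘ suc))) (sym (*-distribˡ-+ c (f 0) _))

∑-const : ∀ n c → ∑[ _ < n ] c ≡ n * c
∑-const zero    c = refl
∑-const (suc n) c = cong (c +_) (∑-const n c)

∑-mono-≤ : ∀ n {f g} → (∀ i → i < n → f i ≤ g i) → ∑ n f ≤ ∑ n g
∑-mono-≤ zero    f≤g = z≤n
∑-mono-≤ (suc n) f≤g = +-mono-≤ (f≤g 0 (s≤s z≤n)) (∑-mono-≤ n (λ i i<n → f≤g (suc i) (s≤s i<n)))

∑-++ : ∀ m n f → ∑ (m + n) f ≡ ∑ m f + ∑[ i < n ] f (m + i)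
∑-++ zero    n f = refl
∑-++ (suc m) n f = trans (cong (f 0 +_) (∑-++ m n (f ∘ suc))) (sym (+-assoc (f 0) _ _))

∑-last : ∀ n f → ∑ (suc n) f ≡ ∑ n f + f n
∑-last n f = begin
  ∑ (suc n) f                ≡⟨ cong (λ m → ∑ m f) (+-comm 1 n) ⟩
  ∑ (n + 1) f                ≡⟨ ∑-++ n 1 f ⟩
  ∑ n f + (f (n + 0) + 0)    ≡⟨ cong (λ x → ∑ n f + x) (trans (+-identityʳ _) (cong f (+-identityʳ n))) ⟩
  ∑ n f + f n                ∎
  where open ≡-Reasoning

∑-comm : ∀ m n (f : ℕ → ℕ → ℕ) → ∑[ i < m ] ∑[ j < n ] f i j ≡ ∑[ j < n ] ∑[ i < m ] f i j
∑-comm zero    n f = sym (trans (∑-cong n (λ _ _ → refl)) (trans (∑-const n 0) (*-zeroʳ n)))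
∑-comm (suc m) n f = begin
  ∑ n (f 0) + ∑[ i < m ] ∑[ j < n ] f (suc i) j   ≡⟨ cong (∑ n (f 0) +_) (∑-comm m n (f ∘ suc)) ⟩
  ∑ n (f 0) + ∑[ j < n ] ∑[ i < m ] f (suc i) j   ≡⟨ ∑-+ n (f 0) (λ j → ∑[ i < m ] f (suc i) j) ⟨
  ∑[ j < n ] ∑[ i < suc m ] f i j                  ∎
  where open ≡-Reasoning

∑-blocks : ∀ m n f → ∑ (m * n) f ≡ ∑[ k < n ] ∑[ i < m ] f (m * k + i)
∑-blocks m zero    f = cong (λ x → ∑ x f) (*-zeroʳ m)
∑-blocks m (suc n) f = begin
  ∑ (m * suc n) f                        ≡⟨ cong (λ x → ∑ x f) (*-suc m n) ⟩
  ∑ (m + m * n) f                        ≡⟨ ∑-++ m (m * n) f ⟩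
  ∑ m f + ∑[ i < m * n ] f (m + i)       ≡⟨ cong₂ _+_ first-block (∑-blocks m n (λ i → f (m + i))) ⟩
  ∑[ i < m ] f (m * 0 + i) + ∑[ k < n ] ∑[ i < m ] f (m + (m * k + i))
    ≡⟨ cong (∑[ i < m ] f (m * 0 + i) +_) (∑-cong n λ k _ → ∑-cong m λ i _ → cong f (shift k i)) ⟩
  ∑[ k < suc n ] ∑[ i < m ] f (m * k + i) ∎
  where
  open ≡-Reasoning
  first-block : ∑ m f ≡ ∑[ i < m ] f (m * 0 + i)
  first-block = ∑-cong m λ i _ → cong f (sym (cong (_+ i) (*-zeroʳ m)))
  shift : ∀ k i → m + (m * k + i) ≡ m * suc k + i
  shift k i = trans (sym (+-assoc m (m * k) i)) (cong (_+ i) (sym (*-suc m k)))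

∑-below-block : ∀ m k i g → ∑ (m * k + i) g ≡ ∑[ l < k ] ∑[ j < m ] g (m * l + j) + ∑[ j < i ] g (m * k + j)
∑-below-block m k i g = trans (∑-++ (m * k) i g) (cong (_+ ∑[ j < i ] g (m * k + j)) (∑-blocks m k g))

∑∑-separable : ∀ m m′ f Y g → ∑[ i < m ] ∑[ j < m′ ] (f j + Y + g i) ≡ m * (∑ m′ f + m′ * Y) + m′ * ∑ m g
∑∑-separable m m′ f Y g = begin
  ∑[ i < m ] ∑[ j < m′ ] (f j + Y + g i)        ≡⟨ ∑-cong m (λ i _ → row i) ⟩
  ∑[ i < m ] (∑ m′ f + m′ * Y + m′ * g i)       ≡⟨ ∑-+ m _ _ ⟩
  ∑[ _ < m ] (∑ m′ f + m′ * Y) + ∑[ i < m ] (m′ * g i)  ≡⟨ cong₂ _+_ (∑-const m _) (∑-*ˡ m m′ g) ⟩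
  m * (∑ m′ f + m′ * Y) + m′ * ∑ m g            ∎
  where
  open ≡-Reasoning
  row : ∀ i → ∑[ j < m′ ] (f j + Y + g i) ≡ ∑ m′ f + m′ * Y + m′ * g i
  row i = trans (∑-+ m′ (λ j → f j + Y) (λ _ → g i))
                (cong₂ _+_ (trans (∑-+ m′ f (λ _ → Y)) (cong (∑ m′ f +_) (∑-const m′ Y))) (∑-const m′ (g i)))

∑∑-linear : ∀ n c (b g : ℕ → ℕ → ℕ) m →
  ∑[ k < n ] (c + ∑[ l < k ] (b k l + m * g k l)) ≡ ∑[ k < n ] (c + ∑[ l < k ] b k l) + m * ∑[ k < n ] ∑[ l < k ] g k l
∑∑-linear n c b g m = begin
  ∑[ k < n ] (c + ∑[ l < k ] (b k l + m * g k l))           ≡⟨ ∑-cong n (λ k _ → cong (c +_) (split k)) ⟩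
  ∑[ k < n ] (c + (∑ k (b k) + m * ∑ k (g k)))             ≡⟨ ∑-cong n (λ k _ → sym (+-assoc c _ _)) ⟩
  ∑[ k < n ] (c + ∑ k (b k) + m * ∑ k (g k))               ≡⟨ ∑-+ n _ _ ⟩
  ∑[ k < n ] (c + ∑ k (b k)) + ∑[ k < n ] (m * ∑ k (g k))  ≡⟨ cong (∑[ k < n ] (c + ∑ k (b k)) +_) (∑-*ˡ n m _) ⟩
  ∑[ k < n ] (c + ∑ k (b k)) + m * ∑[ k < n ] ∑ k (g k)    ∎
  where
  open ≡-Reasoning
  split : ∀ k → ∑[ l < k ] (b k l + m * g k l) ≡ ∑ k (b k) + m * ∑ k (g k)
  split k = trans (∑-+ k (b k) (λ l → m * g k l)) (cong (∑ k (b k) +_) (∑-*ˡ k m (g k)))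

-- Distances in a hexagon

hexDist : ℕ → ℕ → ℕ
hexDist i j = ∣ i - j ∣ ⊓ (6 ∸ ∣ i - j ∣)

next : ℕ → ℕ
next 5 = 0
next r = suc r

prev : ℕ → ℕ
prev 0 = 5
prev (suc r) = r

Near : ℕ → ℕ → Set
Near m n = m ≤ suc n × n ≤ suc m

near? : Decidable₂ Near
near? m n = (m ≤? suc n) ×-dec (n ≤? suc m)

Near-+ʳ : ∀ {m n} c → Near m n → Near (m + c) (n + c)
Near-+ʳ c (m≤1+n , n≤1+m) = +-monoˡ-≤ c m≤1+n , +-monoˡ-≤ c n≤1+m

Near-+ˡ : ∀ {m n} c → Near m n → Near (c + m) (c + n)
Near-+ˡ {m} {n} c mn = subst₂ Near (+-comm m c) (+-comm n c) (Near-+ʳ c mn)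

Near-sym : ∀ {m n} → Near m n → Near n m
Near-sym (m≤1+n , n≤1+m) = n≤1+m , m≤1+n

Near-+1 : ∀ {m n} → m + 1 ≡ n → Near m n
Near-+1 {m} refl = ≤-trans (m≤m+n m 1) (n≤1+n _) , ≤-reflexive (+-comm m 1)

decide<6 : {P : ℕ → Set} (P? : Decidable P) → True (all? (P? ∘ toℕ {6})) →
           ∀ {r} → r < 6 → P r
decide<6 {P} P? ok r<6 = subst P (toℕ-fromℕ< r<6) (toWitness ok (fromℕ< r<6))

decide<6² : {P : ℕ → ℕ → Set} (P? : Decidable₂ P) →
            True (all? λ (r : Fin 6) → all? λ (x : Fin 6) → P? (toℕ r) (toℕ x)) →
            ∀ {r x} → r < 6 → x < 6 → P r x
decide<6² {P} P? ok r<6 x<6 =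
  subst₂ P (toℕ-fromℕ< r<6) (toℕ-fromℕ< x<6) (toWitness ok (fromℕ< r<6) (fromℕ< x<6))

next<6 : ∀ {r} → r < 6 → next r < 6
next<6 = decide<6 (λ r → suc (next r) ≤? 6) _

prev<6 : ∀ {r} → r < 6 → prev r < 6
prev<6 = decide<6 (λ r → suc (prev r) ≤? 6) _

next-prev : ∀ {r} → r < 6 → next (prev r) ≡ r
next-prev = decide<6 (λ r → next (prev r) ≟ r) _

hexDist-sym : ∀ i j → hexDist i j ≡ hexDist j i
hexDist-sym i j = cong (λ d → d ⊓ (6 ∸ d)) (∣-∣-comm i j)

hexDist-self : ∀ i → hexDist i i ≡ 0
hexDist-self i = cong (λ d → d ⊓ (6 ∸ d)) (∣n-n∣≡0 i)

hexDist≤3 : ∀ i j → hexDist i j ≤ 3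
hexDist≤3 i j with ∣ i - j ∣
... | 0 = z≤n
... | 1 = s≤s z≤n
... | 2 = s≤s (s≤s z≤n)
... | suc (suc (suc d)) = ≤-trans (m⊓n≤n _ (3 ∸ d)) (m∸n≤m 3 d)

hexDist-near-next : ∀ {r x} → r < 6 → x < 6 → Near (hexDist r x) (hexDist (next r) x)
hexDist-near-next = decide<6² (λ r x → near? (hexDist r x) (hexDist (next r) x)) _

hexDist-geodesic : ∀ {r x} → r < 6 → x < 6 →
  iterate next r (hexDist r x) ≡ x ⊎ iterate prev r (hexDist r x) ≡ x
hexDist-geodesic =
  decide<6² (λ r x → (iterate next r (hexDist r x) ≟ x) ⊎-dec (iterate prev r (hexDist r x) ≟ x)) _

hexDist-row-sum : ∀ {x} → x < 6 → ∑[ j < 6 ] hexDist j x ≡ 9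
hexDist-row-sum = decide<6 (λ x → ∑[ j < 6 ] hexDist j x ≟ 9) _

oriented : ℕ → ℕ → ℕ × ℕ → Bool
oriented u v e = (proj₁ e ≡ᵇ u) ∧ (proj₂ e ≡ᵇ v)

oriented-sound : ∀ {u v e} → T (oriented u v e) → e ≡ (u , v)
oriented-sound {u} {v} {a , b} ok with Equivalence.to T-∧ ok
... | a≡u , b≡v = cong₂ _,_ (≡ᵇ⇒≡ a u a≡u) (≡ᵇ⇒≡ b v b≡v)

oriented-complete : ∀ u v → T (oriented u v (u , v))
oriented-complete u v = Equivalence.from T-∧ (≡⇒≡ᵇ u u refl , ≡⇒≡ᵇ v v refl)

module _ (G : Graph) where

  adj⇔edge : ∀ {u v} → T (adj G u v) ⇔ ((u , v) ∈ edges G ⊎ (v , u) ∈ edges G)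
  adj⇔edge {u} {v} = mk⇔ to from
    where
    to : T (adj G u v) → (u , v) ∈ edges G ⊎ (v , u) ∈ edges G
    to uv with find (any⁻ _ (edges G) uv)
    ... | e , e∈ , ok with Equivalence.to T-∨ ok
    ... | inj₁ e≡uv = inj₁ (subst (_∈ edges G) (oriented-sound e≡uv) e∈)
    ... | inj₂ e≡vu = inj₂ (subst (_∈ edges G) (oriented-sound e≡vu) e∈)
    from : (u , v) ∈ edges G ⊎ (v , u) ∈ edges G → T (adj G u v)
    from (inj₁ uv∈) = any⁺ _ (lose uv∈ (Equivalence.from T-∨ (inj₁ (oriented-complete u v))))
    from (inj₂ vu∈) = any⁺ _ (lose vu∈ (Equivalence.from T-∨ (inj₂ (oriented-complete v u))))

  adj-sym : ∀ {u v} → T (adj G u v) → T (adj G v u)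
  adj-sym uv = Equivalence.from adj⇔edge (swap (Equivalence.to adj⇔edge uv))

-- Wrapping T (reach G k u v) lets Agda infer k, u and v.
record Reaches (G : Graph) (k u v : ℕ) : Set where
  constructor reaches
  field reached : T (reach G k u v)

module _ {G : Graph} where

  reach-refl : ∀ u → Reaches G 0 u u
  reach-refl u = reaches (≡⇒≡ᵇ u u refl)

  reach-suc : ∀ {k u v} → Reaches G k u v → Reaches G (suc k) u v
  reach-suc (reaches uv) = reaches (Equivalence.from T-∨ (inj₁ uv))

  reach-step : ∀ {k u w v} → T (adj G u w) → w < size G → Reaches G k w v → Reaches G (suc k) u v
  reach-step uw w<size (reaches wv) =
    reaches (Equivalence.from T-∨ (inj₂ (any⁺ _ (lose (∈-upTo⁺ w<size) (Equivalence.from T-∧ (uw , wv))))))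

  reach-inv : ∀ {k u v} → Reaches G (suc k) u v →
              Reaches G k u v ⊎ Σ ℕ λ w → w < size G × T (adj G u w) × Reaches G k w v
  reach-inv (reaches uv) with Equivalence.to T-∨ uv
  ... | inj₁ uv′ = inj₁ (reaches uv′)
  ... | inj₂ via with find (any⁻ _ _ via)
  ... | w , w∈ , ok with Equivalence.to T-∧ ok
  ... | uw , wv = inj₂ (w , ∈-upTo⁻ w∈ , uw , reaches wv)

  reach-++ : ∀ {k m u w v} → Reaches G k u w → Reaches G m w v → Reaches G (k + m) u v
  reach-++ {zero} {u = u} {w} (reaches uw) wv rewrite ≡ᵇ⇒≡ u w uw = wv
  reach-++ {suc k} uw wv with reach-inv uw
  ... | inj₁ uw′ = reach-suc (reach-++ uw′ wv)
  ... | inj₂ (x , x<size , ux , xw) = reach-step ux x<size (reach-++ xw wv)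

  reach-iterate : ∀ {In : ℕ → Set} (pos s : ℕ → ℕ) →
    (∀ {r} → In r → In (s r)) → (∀ {r} → In r → pos r < size G) →
    (∀ {r} → In r → T (adj G (pos r) (pos (s r)))) →
    ∀ m {r} → In r → Reaches G m (pos r) (pos (iterate s r m))
  reach-iterate pos s s-closed pos<size step zero    {r} _  = reach-refl (pos r)
  reach-iterate pos s s-closed pos<size step (suc m) r∈ =
    reach-step (step r∈) (pos<size (s-closed r∈))
               (reach-iterate pos s s-closed pos<size step m (s-closed r∈))

search-least : ∀ (p : ℕ → Bool) fuel s {d} → s ≤ d → d ≤ s + fuel →
               (∀ {m} → m < d → ¬ T (p m)) → T (p d) → search p fuel s ≡ d
search-least p zero s s≤d d≤s+0 _ _ = ≤-antisym s≤d (subst (_ ≤_) (+-identityʳ s) d≤s+0)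
search-least p (suc fuel) s {d} s≤d d≤s+fuel below pd with p s in ps
... | true  = ≤-antisym s≤d (≮⇒≥ λ s<d → below s<d (subst T (sym ps) _))
... | false = search-least p fuel (suc s) s<d (subst (d ≤_) (+-suc s fuel) d≤s+fuel) below pd
  where
  s<d : s < d
  s<d with m≤n⇒m<n∨m≡n s≤d
  ... | inj₁ s<d = s<d
  ... | inj₂ refl = contradiction (subst T ps pd) λ ()

-- A potential that vanishes on the diagonal and changes by at most one along edges bounds
-- the length of every walk from below; once attained by a walk it is the distance.
module Potential {G : Graph} (D : ℕ → ℕ → ℕ) (D-self : ∀ v → D v v ≡ 0)
                 (D-edge : ∀ {x y} → (x , y) ∈ edges G → ∀ v → Near (D x v) (D y v)) where

  D-adj : ∀ {u w} v → T (adj G u w) → D u v ≤ suc (D w v)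
  D-adj v uw with Equivalence.to (adj⇔edge G) uw
  ... | inj₁ uw∈ = proj₁ (D-edge uw∈ v)
  ... | inj₂ wu∈ = proj₂ (D-edge wu∈ v)

  reach⇒potential≤ : ∀ {k u v} → Reaches G k u v → D u v ≤ k
  reach⇒potential≤ {zero} {u} {v} (reaches uv) rewrite ≡ᵇ⇒≡ u v uv | D-self v = z≤n
  reach⇒potential≤ {suc k} uv with reach-inv uv
  ... | inj₁ uv′ = m≤n⇒m≤1+n (reach⇒potential≤ uv′)
  ... | inj₂ (w , _ , uw , wv) = ≤-trans (D-adj _ uw) (s≤s (reach⇒potential≤ wv))

  dist≡potential : ∀ {u v} → Reaches G (D u v) u v → D u v ≤ size G → dist G u v ≡ D u v
  dist≡potential (reaches uv) D≤size =
    search-least _ _ 0 z≤n D≤size (λ m<D reached → <⇒≱ m<D (reach⇒potential≤ (reaches reached))) uv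

-- Distances in a hexagonal chain

-- chainDist t a l j k i is the distance from vertex j of hexagon l to vertex i of hexagon k
-- when vertex a m of hexagon m is linked to vertex 0 of hexagon m + 1 at cost t (1 for a cut
-- edge, 0 for a shared vertex); transit t a l d is the cost of crossing the d hexagons after
-- hexagon l.
transit : ℕ → (ℕ → ℕ) → ℕ → ℕ → ℕ
transit t a l d = ∑[ m < d ] (hexDist 0 (a (suc l + m)) + t)

chainDist : ℕ → (ℕ → ℕ) → ℕ → ℕ → ℕ → ℕ → ℕ
chainDist t a zero    j zero    i = hexDist j i
chainDist t a zero    j (suc k) i = hexDist j (a 0) + t + transit t a 0 k + hexDist 0 i
chainDist t a (suc l) j zero    i = hexDist i (a 0) + t + transit t a 0 l + hexDist 0 j
chainDist t a (suc l) j (suc k) i = chainDist t (a ∘ suc) l j k i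

chainDist-same : ∀ t a k j i → chainDist t a k j k i ≡ hexDist j i
chainDist-same t a zero    j i = refl
chainDist-same t a (suc k) j i = chainDist-same t (a ∘ suc) k j i

chainDist-sym : ∀ t a l j k i → chainDist t a l j k i ≡ chainDist t a k i l j
chainDist-sym t a zero    j zero    i = hexDist-sym j i
chainDist-sym t a zero    j (suc k) i = refl
chainDist-sym t a (suc l) j zero    i = refl
chainDist-sym t a (suc l) j (suc k) i = chainDist-sym t (a ∘ suc) l j k i

chainDist-across : ∀ t a l d j i →
  chainDist t a l j (suc (l + d)) i ≡ hexDist j (a l) + t + transit t a l d + hexDist 0 i
chainDist-across t a zero    d j i = refl
chainDist-across t a (suc l) d j i = chainDist-across t (a ∘ suc) l d j i

chainDist-near-next : ∀ t {a} → (∀ m → a m < 6) → ∀ l k {r i} → r < 6 → i < 6 →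
  Near (chainDist t a l r k i) (chainDist t a l (next r) k i)
chainDist-near-next t a<6 zero zero r<6 i<6 = hexDist-near-next r<6 i<6
chainDist-near-next t {a} a<6 zero (suc k) {i = i} r<6 _ =
  Near-+ʳ (hexDist 0 i) (Near-+ʳ (transit t a 0 k) (Near-+ʳ t (hexDist-near-next r<6 (a<6 0))))
chainDist-near-next t {a} a<6 (suc l) zero {r} {i} r<6 _ =
  Near-+ˡ (hexDist i (a 0) + t + transit t a 0 l)
    (subst₂ Near (hexDist-sym r 0) (hexDist-sym (next r) 0) (hexDist-near-next r<6 (s≤s z≤n)))
chainDist-near-next t a<6 (suc l) (suc k) r<6 i<6 = chainDist-near-next t (a<6 ∘ suc) l k r<6 i<6

chainDist-cut : ∀ t a h k i →
  chainDist t a (suc h) 0 k i + t ≡ chainDist t a h (a h) k i ⊎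
  chainDist t a h (a h) k i + t ≡ chainDist t a (suc h) 0 k i
chainDist-cut t a zero zero i rewrite hexDist-sym (a 0) i = inj₂ (lemma (hexDist i (a 0)) t)
  where
  lemma : ∀ x t → x + t ≡ x + t + 0 + 0
  lemma = solve-∀
chainDist-cut t a zero (suc zero) i rewrite hexDist-self (a 0) = inj₁ (lemma (hexDist 0 i) t)
  where
  lemma : ∀ x t → x + t ≡ t + 0 + x
  lemma = solve-∀
chainDist-cut t a zero (suc (suc k)) i rewrite hexDist-self (a 0) =
  inj₁ (lemma (hexDist 0 (a 1)) t (transit t (a ∘ suc) 0 k) (hexDist 0 i))
  where
  lemma : ∀ x t y z → x + t + y + z + t ≡ t + (x + t + y) + z
  lemma = solve-∀
chainDist-cut t a (suc h) zero i rewrite ∑-last h (λ m → hexDist 0 (a (suc m)) + t) =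
  inj₂ (lemma (hexDist i (a 0)) t (transit t a 0 h) (hexDist 0 (a (suc h))))
  where
  lemma : ∀ x t y z → x + t + y + z + t ≡ x + t + (y + (z + t)) + 0
  lemma = solve-∀
chainDist-cut t a (suc h) (suc k) i = chainDist-cut t (a ∘ suc) h k i

chainDist-cut₀ : ∀ a h k i → chainDist 0 a (suc h) 0 k i ≡ chainDist 0 a h (a h) k i
chainDist-cut₀ a h k i with chainDist-cut 0 a h k i
... | inj₁ eq = trans (sym (+-identityʳ _)) eq
... | inj₂ eq = sym (trans (sym (+-identityʳ _)) eq)

transit≤ : ∀ t a l d → transit t a l d ≤ d * (3 + t)
transit≤ t a l d = ≤-trans (∑-mono-≤ d (λ m _ → +-monoˡ-≤ t (hexDist≤3 0 _))) (≤-reflexive (∑-const d (3 + t)))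

transit-split : ∀ t a l d → transit t a l d ≡ transit 0 a l d + d * t
transit-split t a l d = begin
  ∑[ m < d ] (hexDist 0 (a (suc l + m)) + t)        ≡⟨ ∑-cong d (λ m _ → cong (_+ t) (sym (+-identityʳ _))) ⟩
  ∑[ m < d ] (hexDist 0 (a (suc l + m)) + 0 + t)    ≡⟨ ∑-+ d _ _ ⟩
  transit 0 a l d + ∑[ _ < d ] t                    ≡⟨ cong (transit 0 a l d +_) (∑-const d t) ⟩
  transit 0 a l d + d * t                           ∎
  where open ≡-Reasoning

chainDist-across≤ : ∀ t a l d j i → chainDist t a l j (suc (l + d)) i ≤ (3 + t) * (2 + d)
chainDist-across≤ t a l d j i = begin
  chainDist t a l j (suc (l + d)) i                    ≡⟨ chainDist-across t a l d j i ⟩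
  hexDist j (a l) + t + transit t a l d + hexDist 0 i  ≤⟨ +-mono-≤ (+-mono-≤ (+-monoˡ-≤ t (hexDist≤3 j (a l)))
                                                              (transit≤ t a l d)) (hexDist≤3 0 i) ⟩
  3 + t + d * (3 + t) + 3                              ≤⟨ m≤m+n _ t ⟩
  3 + t + d * (3 + t) + 3 + t                          ≡⟨ lemma t d ⟩
  (3 + t) * (2 + d)                                    ∎
  where
  open ≤-Reasoning
  lemma : ∀ t d → 3 + t + d * (3 + t) + 3 + t ≡ (3 + t) * (2 + d)
  lemma = solve-∀

module ChainDistances
  (G : Graph) (t n : ℕ) (a : ℕ → ℕ) (a<6 : ∀ m → a m < 6) (pos : ℕ → ℕ → ℕ)
  (size-large : (3 + t) * n ≤ size G)
  (pos<size : ∀ {k i} → k < n → i < 6 → pos k i < size G)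
  (hexagon-adj : ∀ {k r} → k < n → r < 6 → T (adj G (pos k r) (pos k (next r))))
  (cut-reach : ∀ {k} → suc k < n → Reaches G t (pos k (a k)) (pos (suc k) 0))
  (D : ℕ → ℕ → ℕ) (D-self : ∀ v → D v v ≡ 0)
  (D-edge : ∀ {x y} → (x , y) ∈ edges G → ∀ v → Near (D x v) (D y v))
  (D-pos : ∀ {l j k i} → l < n → j < 6 → k < n → i < 6 → D (pos l j) (pos k i) ≡ chainDist t a l j k i)
  where

  open Potential {G} D D-self D-edge

  hexagon-reach : ∀ {k j i} → k < n → j < 6 → i < 6 → Reaches G (hexDist j i) (pos k j) (pos k i)
  hexagon-reach {k} {j} {i} k<n j<6 i<6 with hexDist-geodesic j<6 i<6
  ... | inj₁ forward  = subst (Reaches G (hexDist j i) (pos k j) ∘ pos k) forward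
                          (reach-iterate (pos k) next next<6 (pos<size k<n) (hexagon-adj k<n) (hexDist j i) j<6)
  ... | inj₂ backward = subst (Reaches G (hexDist j i) (pos k j) ∘ pos k) backward
                          (reach-iterate (pos k) prev prev<6 (pos<size k<n) backward-adj (hexDist j i) j<6)
    where
    backward-adj : ∀ {r} → r < 6 → T (adj G (pos k r) (pos k (prev r)))
    backward-adj {r} r<6 = subst (λ x → T (adj G (pos k x) (pos k (prev r)))) (next-prev r<6)
                                 (adj-sym G (hexagon-adj k<n (prev<6 r<6)))

  transit-reach : ∀ l d → suc (l + d) < n → Reaches G (transit t a l d) (pos (suc l) 0) (pos (suc (l + d)) 0)
  transit-reach l zero    _ = subst (λ x → Reaches G 0 (pos (suc l) 0) (pos (suc x) 0)) (sym (+-identityʳ l)) (reach-refl _)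
  transit-reach l (suc d) l+d+2<n =
    subst₂ (λ x y → Reaches G x (pos (suc l) 0) (pos y 0))
      (trans (+-assoc (transit t a l d) _ t) (sym (∑-last d _))) (cong suc (sym (+-suc l d)))
      (reach-++ (reach-++ (transit-reach l d (<-trans (n<1+n _) l+d+2<n′))
                          (hexagon-reach (<-trans (n<1+n _) l+d+2<n′) (s≤s z≤n) (a<6 _)))
                (cut-reach l+d+2<n′))
    where
    l+d+2<n′ : suc (suc (l + d)) < n
    l+d+2<n′ = subst (λ x → suc x < n) (+-suc l d) l+d+2<n

  across-reach : ∀ l d {j i} → suc (l + d) < n → j < 6 → i < 6 →
    Reaches G (hexDist j (a l) + t + transit t a l d + hexDist 0 i) (pos l j) (pos (suc (l + d)) i)
  across-reach l d k<n j<6 i<6 =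
    reach-++ (reach-++ (reach-++ (hexagon-reach l<n j<6 (a<6 l)) (cut-reach l+1<n)) (transit-reach l d k<n))
             (hexagon-reach k<n (s≤s z≤n) i<6)
    where
    l+1<n : suc l < n
    l+1<n = ≤-<-trans (s≤s (m≤m+n l d)) k<n
    l<n : l < n
    l<n = <-trans (n<1+n l) l+1<n

  dist≡chainDist : ∀ {l j k i} → l < n → j < 6 → k < n → i < 6 →
    Reaches G (chainDist t a l j k i) (pos l j) (pos k i) → chainDist t a l j k i ≤ (3 + t) * n →
    dist G (pos l j) (pos k i) ≡ chainDist t a l j k i
  dist≡chainDist {l} {j} {k} {i} l<n j<6 k<n i<6 walk bound = trans
    (dist≡potential (subst (λ x → Reaches G x (pos l j) (pos k i)) (sym D≡) walk)
                    (subst (_≤ size G) (sym D≡) (≤-trans bound size-large)))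
    D≡
    where
    D≡ : D (pos l j) (pos k i) ≡ chainDist t a l j k i
    D≡ = D-pos l<n j<6 k<n i<6

  dist-within : ∀ {k j i} → k < n → j < 6 → i < 6 → dist G (pos k j) (pos k i) ≡ hexDist j i
  dist-within {k} {j} {i} k<n j<6 i<6 =
    trans (dist≡chainDist k<n j<6 k<n i<6 (subst (λ x → Reaches G x _ _) (sym same) (hexagon-reach k<n j<6 i<6))
                          (subst (_≤ (3 + t) * n) (sym same) hexDist≤size))
          same
    where
    same : chainDist t a k j k i ≡ hexDist j i
    same = chainDist-same t a k j i
    hexDist≤size : hexDist j i ≤ (3 + t) * n
    hexDist≤size = ≤-trans (hexDist≤3 j i) (≤-trans (m≤m+n 3 t)
                     (≤-trans (≤-reflexive (sym (*-identityʳ (3 + t)))) (*-monoʳ-≤ (3 + t) (≤-trans (s≤s z≤n) k<n))))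

  dist-across′ : ∀ l d {j i} → suc (l + d) < n → j < 6 → i < 6 →
    dist G (pos l j) (pos (suc (l + d)) i) ≡ hexDist j (a l) + t + transit t a l d + hexDist 0 i
  dist-across′ l d {j} {i} k<n j<6 i<6 =
    trans (dist≡chainDist l<n j<6 k<n i<6 (subst (λ x → Reaches G x (pos l j) (pos (suc (l + d)) i)) (sym across)
                                                 (across-reach l d k<n j<6 i<6))
                          (≤-trans (chainDist-across≤ t a l d j i) (*-monoʳ-≤ (3 + t) d+2≤n)))
          across
    where
    across : chainDist t a l j (suc (l + d)) i ≡ hexDist j (a l) + t + transit t a l d + hexDist 0 i
    across = chainDist-across t a l d j i
    l<n : l < n
    l<n = ≤-<-trans (≤-trans (m≤m+n l d) (n≤1+n _)) k<n
    d+2≤n : 2 + d ≤ n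
    d+2≤n = ≤-trans (s≤s (s≤s (m≤n+m d l))) k<n

  dist-across : ∀ {l k j i} → l < k → k < n → j < 6 → i < 6 →
    dist G (pos l j) (pos k i) ≡ hexDist j (a l) + t + transit t a l (k ∸ suc l) + hexDist 0 i
  dist-across {l} {k} {j} {i} l<k k<n j<6 i<6 =
    subst (λ x → dist G (pos l j) (pos x i) ≡ hexDist j (a l) + t + transit t a l (k ∸ suc l) + hexDist 0 i) k≡
          (dist-across′ l (k ∸ suc l) (subst (_< n) (sym k≡) k<n) j<6 i<6)
    where
    k≡ : suc (l + (k ∸ suc l)) ≡ k
    k≡ = m+[n∸m]≡n l<k

  dist-from-start : ∀ {k i} → k < n → i < 6 → dist G (pos 0 0) (pos k i) ≡ ∑[ l < k ] (hexDist 0 (a l) + t) + hexDist 0 i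
  dist-from-start {zero}  k<n i<6 = dist-within k<n (s≤s z≤n) i<6
  dist-from-start {suc k} k<n i<6 = dist-across′ 0 k k<n (s≤s z≤n) i<6

-- Polyphenyl and spiro chains

/-block : ∀ d k {i} .{{_ : NonZero d}} → i < d → (d * k + i) / d ≡ k
/-block d k {i} i<d = begin
  (d * k + i) / d    ≡⟨ +-distrib-/-∣ˡ i (m∣m*n k) ⟩
  d * k / d + i / d  ≡⟨ cong₂ _+_ (trans (/-congˡ (*-comm d k)) (m*n/n≡m k d)) (m<n⇒m/n≡0 i<d) ⟩
  k + 0              ≡⟨ +-identityʳ k ⟩
  k                  ∎
  where open ≡-Reasoning

%-block : ∀ d k {i} .{{_ : NonZero d}} → i < d → (d * k + i) % d ≡ i
%-block d k i<d = trans (%-remove-+ˡ _ (m∣m*n k)) (m<n⇒m%n≡m i<d)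

hexagon : (ℕ → ℕ → ℕ) → ℕ → List (ℕ × ℕ)
hexagon f k = (f k 0 , f k 1) ∷ (f k 1 , f k 2) ∷ (f k 2 , f k 3) ∷
              (f k 3 , f k 4) ∷ (f k 4 , f k 5) ∷ (f k 5 , f k 0) ∷ []

hexagon-∈ : ∀ f k {r} → r < 6 → (f k r , f k (next r)) ∈ hexagon f k
hexagon-∈ f k {0} _ = here refl
hexagon-∈ f k {1} _ = there (here refl)
hexagon-∈ f k {2} _ = there (there (here refl))
hexagon-∈ f k {3} _ = there (there (there (here refl)))
hexagon-∈ f k {4} _ = there (there (there (there (here refl))))
hexagon-∈ f k {5} _ = there (there (there (there (there (here refl)))))
hexagon-∈ f k {suc (suc (suc (suc (suc (suc _)))))} (s≤s (s≤s (s≤s (s≤s (s≤s (s≤s ()))))))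

∈-hexagon : ∀ f k {e} → e ∈ hexagon f k → Σ ℕ λ r → r < 6 × e ≡ (f k r , f k (next r))
∈-hexagon f k (here refl)                                           = 0 , s≤s z≤n , refl
∈-hexagon f k (there (here refl))                                   = 1 , s≤s (s≤s z≤n) , refl
∈-hexagon f k (there (there (here refl)))                           = 2 , s≤s (s≤s (s≤s z≤n)) , refl
∈-hexagon f k (there (there (there (here refl))))                   = 3 , s≤s (s≤s (s≤s (s≤s z≤n))) , refl
∈-hexagon f k (there (there (there (there (here refl)))))           = 4 , s≤s (s≤s (s≤s (s≤s (s≤s z≤n)))) , refl
∈-hexagon f k (there (there (there (there (there (here refl)))))) = 5 , ≤-refl , refl

hexEdges-∈ : ∀ n f {k r} → k < n → r < 6 → (f k r , f k (next r)) ∈ hexEdges n f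
hexEdges-∈ n f {k} k<n r<6 = ∈-concatMap⁺ (hexagon f) (lose (∈-upTo⁺ k<n) (hexagon-∈ f k r<6))

∈-hexEdges : ∀ n f {e} → e ∈ hexEdges n f →
  Σ ℕ λ k → Σ ℕ λ r → k < n × r < 6 × e ≡ (f k r , f k (next r))
∈-hexEdges n f e∈ with find (∈-concatMap⁻ (hexagon f) {xs = upTo n} e∈)
... | k , k∈ , e∈hexagon with ∈-hexagon f k e∈hexagon
... | r , r<6 , e≡ = k , r , ∈-upTo⁻ k∈ , r<6 , e≡

att<6 : ∀ {m} (c : Vec (Fin 5) m) j → att c j < 6
att<6 []      j       = s≤s z≤n
att<6 (x ∷ c) zero    = s≤s (toℕ<n x)
att<6 (x ∷ c) (suc j) = att<6 c j

att-positive : ∀ {m} (c : Vec (Fin 5) m) {j} → j < m → 0 < att c j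
att-positive (x ∷ c) {zero}  _         = s≤s z≤n
att-positive (x ∷ c) {suc j} (s≤s j<m) = att-positive c j<m

wiener-∑ : ∀ G → wiener G ≡ ∑[ v < size G ] ∑[ u < v ] dist G u v
wiener-∑ G = trans (sum-upTo _ (size G)) (∑-cong (size G) (λ v _ → sum-upTo _ v))

polyphenyl-block : ∀ {x} → x < 6 → ∀ Y →
  ∑[ i < 6 ] ∑[ j < 6 ] (hexDist j x + 1 + Y + hexDist 0 i) ≡ 144 + 36 * Y
polyphenyl-block {x} x<6 Y = begin
  ∑[ i < 6 ] ∑[ j < 6 ] (hexDist j x + 1 + Y + hexDist 0 i)  ≡⟨ ∑∑-separable 6 6 (λ j → hexDist j x + 1) Y (hexDist 0) ⟩
  6 * (∑[ j < 6 ] (hexDist j x + 1) + 6 * Y) + 6 * 9         ≡⟨ cong (λ r → 6 * (r + 6 * Y) + 54) row ⟩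
  6 * (15 + 6 * Y) + 54                                     ≡⟨ lemma Y ⟩
  144 + 36 * Y                                              ∎
  where
  open ≡-Reasoning
  row : ∑[ j < 6 ] (hexDist j x + 1) ≡ 15
  row = trans (∑-+ 6 (λ j → hexDist j x) (λ _ → 1)) (cong (_+ 6) (hexDist-row-sum x<6))
  lemma : ∀ Y → 6 * (15 + 6 * Y) + 54 ≡ 144 + 36 * Y
  lemma = solve-∀

spiro-block : ∀ {x} → x < 6 → ∀ Y →
  ∑[ i < 5 ] ∑[ j < 5 ] (hexDist (suc j) x + 0 + Y + hexDist 0 (suc i)) + 5 * (hexDist 0 x + 0) ≡ 90 + 25 * Y
spiro-block {x} x<6 Y = begin
  ∑[ i < 5 ] ∑[ j < 5 ] (hexDist (suc j) x + 0 + Y + hexDist 0 (suc i)) + 5 * (hexDist 0 x + 0)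
    ≡⟨ cong (_+ 5 * (hexDist 0 x + 0)) (∑∑-separable 5 5 (λ j → hexDist (suc j) x + 0) Y (hexDist 0 ∘ suc)) ⟩
  5 * (∑[ j < 5 ] (hexDist (suc j) x + 0) + 5 * Y) + 5 * 9 + 5 * (hexDist 0 x + 0)
    ≡⟨ cong (λ r → 5 * (r + 5 * Y) + 45 + 5 * (hexDist 0 x + 0)) (∑-cong 5 (λ j _ → +-identityʳ (hexDist (suc j) x))) ⟩
  5 * (∑[ j < 5 ] hexDist (suc j) x + 5 * Y) + 45 + 5 * (hexDist 0 x + 0)
    ≡⟨ lemma (∑[ j < 5 ] hexDist (suc j) x) (hexDist 0 x) Y ⟩
  5 * (hexDist 0 x + ∑[ j < 5 ] hexDist (suc j) x) + 45 + 25 * Y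
    ≡⟨ cong (λ r → 5 * r + 45 + 25 * Y) (hexDist-row-sum x<6) ⟩
  90 + 25 * Y
    ∎
  where
  open ≡-Reasoning
  lemma : ∀ r h Y → 5 * (r + 5 * Y) + 45 + 5 * (h + 0) ≡ 5 * (h + r) + 45 + 25 * Y
  lemma = solve-∀

innerPassages : ℕ → (ℕ → ℕ) → ℕ
innerPassages n a = ∑[ k < n ] ∑[ l < k ] transit 0 a l (k ∸ suc l)

polyphenylBase : ℕ → ℕ
polyphenylBase n = ∑[ k < n ] (27 + ∑[ l < k ] (144 + 36 * (k ∸ suc l)))

spiroBase : ℕ → ℕ
spiroBase n = ∑[ k < n ] (27 + ∑[ _ < k ] 90)

module Polyphenyl (n : ℕ) (c : Code n) where

  private
    G : Graph
    G = polyphenyl n c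
    cutEdge : ℕ → ℕ × ℕ
    cutEdge j = (polyIdx (suc j) 0 , polyIdx j (att c j))

  potential : ℕ → ℕ → ℕ
  potential u v = chainDist 1 (att c) (u / 6) (u % 6) (v / 6) (v % 6)

  potential-pos : ∀ l k {j i} → j < 6 → i < 6 → potential (polyIdx l j) (polyIdx k i) ≡ chainDist 1 (att c) l j k i
  potential-pos l k {j} {i} j<6 i<6
    rewrite /-block 6 l j<6 | %-block 6 l j<6 | /-block 6 k i<6 | %-block 6 k i<6 = refl

  potential-self : ∀ v → potential v v ≡ 0
  potential-self v = trans (chainDist-same 1 (att c) (v / 6) (v % 6) (v % 6)) (hexDist-self (v % 6))

  potential-edge : ∀ {x y} → (x , y) ∈ edges G → ∀ v → Near (potential x v) (potential y v)
  potential-edge xy∈ v with ∈-++⁻ (hexEdges n polyIdx) xy∈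
  ... | inj₁ hexagon∈ with ∈-hexEdges n polyIdx hexagon∈
  ... | k , r , _ , r<6 , refl
    rewrite /-block 6 k r<6 | %-block 6 k r<6 | /-block 6 k (next<6 r<6) | %-block 6 k (next<6 r<6)
    = chainDist-near-next 1 (att<6 c) k (v / 6) r<6 (m%n<n v 6)
  potential-edge xy∈ v | inj₂ cut∈ with ∈-map⁻ cutEdge cut∈
  ... | j , _ , refl
    rewrite /-block 6 (suc j) {0} (s≤s z≤n) | %-block 6 (suc j) {0} (s≤s z≤n)
          | /-block 6 j (att<6 c j) | %-block 6 j (att<6 c j)
    with chainDist-cut 1 (att c) j (v / 6) (v % 6)
  ... | inj₁ eq = Near-+1 eq
  ... | inj₂ eq = Near-sym (Near-+1 eq)

  polyIdx<size : ∀ {k i} → k < n → i < 6 → polyIdx k i < size G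
  polyIdx<size {k} {i} k<n i<6 = begin-strict
    6 * k + i      <⟨ +-monoʳ-< (6 * k) i<6 ⟩
    6 * k + 6      ≡⟨ trans (+-comm (6 * k) 6) (sym (*-suc 6 k)) ⟩
    6 * suc k      ≤⟨ *-monoʳ-≤ 6 k<n ⟩
    6 * n          ∎
    where open ≤-Reasoning

  hexagon-adj : ∀ {k r} → k < n → r < 6 → T (adj G (polyIdx k r) (polyIdx k (next r)))
  hexagon-adj k<n r<6 = Equivalence.from (adj⇔edge G) (inj₁ (∈-++⁺ˡ (hexEdges-∈ n polyIdx k<n r<6)))

  cut-reach : ∀ {k} → suc k < n → Reaches G 1 (polyIdx k (att c k)) (polyIdx (suc k) 0)
  cut-reach {k} k+1<n = reach-step (Equivalence.from (adj⇔edge G) (inj₂ cut∈)) (polyIdx<size k+1<n (s≤s z≤n)) (reach-refl _)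
    where
    cut∈ : (polyIdx (suc k) 0 , polyIdx k (att c k)) ∈ edges G
    cut∈ = ∈-++⁺ʳ (hexEdges n polyIdx) (∈-map⁺ cutEdge (∈-upTo⁺ (∸-monoˡ-≤ 1 k+1<n)))

  open ChainDistances G 1 n (att c) (att<6 c) polyIdx (*-monoˡ-≤ n {4} {6} (s≤s (s≤s (s≤s (s≤s z≤n)))))
                      polyIdx<size hexagon-adj cut-reach potential potential-self potential-edge
                      (λ {l} {_} {k} _ j<6 _ i<6 → potential-pos l k j<6 i<6) public

  -- The pairs inside hexagon k contribute the closed term ∑[ i < 6 ] ∑[ j < i ] hexDist j i,
  -- which reduces to 27, the Wiener index of a hexagon.
  hexagon-sum : ∀ {k} → k < n →
    ∑[ i < 6 ] ∑[ u < 6 * k + i ] dist G u (6 * k + i) ≡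
    27 + ∑[ l < k ] (144 + 36 * transit 1 (att c) l (k ∸ suc l))
  hexagon-sum {k} k<n = begin
    ∑[ i < 6 ] ∑[ u < 6 * k + i ] dist G u (6 * k + i)
      ≡⟨ ∑-cong 6 (λ i i<6 → trans (∑-below-block 6 k i (λ u → dist G u (6 * k + i))) (cong₂ _+_
           (∑-cong k λ l l<k → ∑-cong 6 λ j j<6 → dist-across l<k k<n j<6 i<6)
           (∑-cong i λ j j<i → dist-within k<n (<-trans j<i i<6) i<6))) ⟩
    ∑[ i < 6 ] (∑[ l < k ] ∑[ j < 6 ] across l j i + ∑[ j < i ] hexDist j i)
      ≡⟨ ∑-+ 6 (λ i → ∑[ l < k ] ∑[ j < 6 ] across l j i) (λ i → ∑[ j < i ] hexDist j i) ⟩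
    ∑[ i < 6 ] ∑[ l < k ] ∑[ j < 6 ] across l j i + 27
      ≡⟨ cong (_+ 27) (∑-comm 6 k (λ i l → ∑[ j < 6 ] across l j i)) ⟩
    ∑[ l < k ] ∑[ i < 6 ] ∑[ j < 6 ] across l j i + 27
      ≡⟨ cong (_+ 27) (∑-cong k λ l _ → polyphenyl-block (att<6 c l) (transit 1 (att c) l (k ∸ suc l))) ⟩
    ∑[ l < k ] (144 + 36 * transit 1 (att c) l (k ∸ suc l)) + 27
      ≡⟨ +-comm _ 27 ⟩
    27 + ∑[ l < k ] (144 + 36 * transit 1 (att c) l (k ∸ suc l))
      ∎
    where
    open ≡-Reasoning
    across : ℕ → ℕ → ℕ → ℕ
    across l j i = hexDist j (att c l) + 1 + transit 1 (att c) l (k ∸ suc l) + hexDist 0 i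

  wiener-polyphenyl : wiener G ≡ polyphenylBase n + 36 * innerPassages n (att c)
  wiener-polyphenyl = begin
    wiener G                                                         ≡⟨ wiener-∑ G ⟩
    ∑[ v < 6 * n ] ∑[ u < v ] dist G u v                             ≡⟨ ∑-blocks 6 n _ ⟩
    ∑[ k < n ] ∑[ i < 6 ] ∑[ u < 6 * k + i ] dist G u (6 * k + i)    ≡⟨ ∑-cong n (λ k k<n → hexagon-sum k<n) ⟩
    ∑[ k < n ] (27 + ∑[ l < k ] (144 + 36 * transit 1 (att c) l (k ∸ suc l)))
      ≡⟨ ∑-cong n (λ k _ → cong (27 +_) (∑-cong k λ l _ → unit-cuts l (k ∸ suc l))) ⟩
    ∑[ k < n ] (27 + ∑[ l < k ] (144 + 36 * (k ∸ suc l) + 36 * transit 0 (att c) l (k ∸ suc l)))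
      ≡⟨ ∑∑-linear n 27 _ _ 36 ⟩
    polyphenylBase n + 36 * innerPassages n (att c)                  ∎
    where
    open ≡-Reasoning
    unit-cuts : ∀ l d → 144 + 36 * transit 1 (att c) l d ≡ 144 + 36 * d + 36 * transit 0 (att c) l d
    unit-cuts l d rewrite transit-split 1 (att c) l d = lemma (transit 0 (att c) l d) d
      where
      lemma : ∀ x d → 144 + 36 * (x + d * 1) ≡ 144 + 36 * d + 36 * x
      lemma = solve-∀

module Spiro (n : ℕ) (c : Code n) where

  private
    G : Graph
    G = spiro n c

  -- Vertex 5 k + i + 1 is vertex i + 1 of hexagon k; the shared vertex 0 of hexagon k + 1
  -- is vertex a k of hexagon k.
  hexagonOf : ℕ → ℕ
  hexagonOf zero    = 0
  hexagonOf (suc u) = u / 5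

  vertexOf : ℕ → ℕ
  vertexOf zero    = 0
  vertexOf (suc u) = suc (u % 5)

  vertexOf<6 : ∀ u → vertexOf u < 6
  vertexOf<6 zero    = s≤s z≤n
  vertexOf<6 (suc u) = s≤s (m%n<n u 5)

  spiroIdx-own : ∀ k i → spiroIdx c k (suc i) ≡ suc (5 * k + i)
  spiroIdx-own zero    i = refl
  spiroIdx-own (suc k) i = +-suc (5 * suc k) i

  spiroIdx-shared : ∀ {k} → suc k < n → spiroIdx c (suc k) 0 ≡ spiroIdx c k (att c k)
  spiroIdx-shared {k} k+1<n with att c k | att-positive c (∸-monoˡ-≤ 1 k+1<n)
  ... | suc x | _ = trans (+-suc (5 * k) x) (sym (spiroIdx-own k x))

  decode-spiroIdx : ∀ {k r} K I → k < n → r < 6 →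
    chainDist 0 (att c) (hexagonOf (spiroIdx c k r)) (vertexOf (spiroIdx c k r)) K I ≡ chainDist 0 (att c) k r K I
  decode-spiroIdx {k} {suc r} K I _ (s≤s r<5) rewrite spiroIdx-own k r | /-block 5 k r<5 | %-block 5 k r<5 = refl
  decode-spiroIdx {zero}  {zero} K I _ _ = refl
  decode-spiroIdx {suc k} {zero} K I k+1<n _ rewrite spiroIdx-shared k+1<n =
    trans (decode-spiroIdx K I (<-trans (n<1+n k) k+1<n) (att<6 c k)) (sym (chainDist-cut₀ (att c) k K I))

  potential : ℕ → ℕ → ℕ
  potential u v = chainDist 0 (att c) (hexagonOf u) (vertexOf u) (hexagonOf v) (vertexOf v)

  potential-pos : ∀ {l j k i} → l < n → j < 6 → k < n → i < 6 →
    potential (spiroIdx c l j) (spiroIdx c k i) ≡ chainDist 0 (att c) l j k i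
  potential-pos {l} {j} {k} {i} l<n j<6 k<n i<6 = begin
    potential (spiroIdx c l j) (spiroIdx c k i)                             ≡⟨ decode-spiroIdx _ _ l<n j<6 ⟩
    chainDist 0 (att c) l j (hexagonOf (spiroIdx c k i)) (vertexOf (spiroIdx c k i)) ≡⟨ chainDist-sym 0 (att c) l j _ _ ⟩
    chainDist 0 (att c) (hexagonOf (spiroIdx c k i)) (vertexOf (spiroIdx c k i)) l j ≡⟨ decode-spiroIdx l j k<n i<6 ⟩
    chainDist 0 (att c) k i l j                                             ≡⟨ chainDist-sym 0 (att c) k i l j ⟩
    chainDist 0 (att c) l j k i                                             ∎
    where open ≡-Reasoning

  potential-self : ∀ v → potential v v ≡ 0
  potential-self v = trans (chainDist-same 0 (att c) (hexagonOf v) (vertexOf v) (vertexOf v)) (hexDist-self (vertexOf v))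

  potential-edge : ∀ {x y} → (x , y) ∈ edges G → ∀ v → Near (potential x v) (potential y v)
  potential-edge xy∈ v with ∈-hexEdges n (spiroIdx c) xy∈
  ... | k , r , k<n , r<6 , refl =
    subst₂ Near (sym (decode-spiroIdx _ _ k<n r<6)) (sym (decode-spiroIdx _ _ k<n (next<6 r<6)))
           (chainDist-near-next 0 (att<6 c) k (hexagonOf v) r<6 (vertexOf<6 v))

  spiroIdx<size : ∀ {k r} → k < n → r < 6 → spiroIdx c k r < size G
  spiroIdx<size {k} {suc r} k<n (s≤s r<5) = begin-strict
    spiroIdx c k (suc r) ≡⟨ spiroIdx-own k r ⟩
    suc (5 * k + r) <⟨ s≤s (+-monoʳ-< (5 * k) r<5) ⟩
    suc (5 * k + 5) ≡⟨ cong suc (trans (+-comm (5 * k) 5) (sym (*-suc 5 k))) ⟩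
    suc (5 * suc k) ≤⟨ s≤s (*-monoʳ-≤ 5 k<n) ⟩
    suc (5 * n)     ≡⟨ +-comm 1 (5 * n) ⟩
    5 * n + 1       ∎
    where open ≤-Reasoning
  spiroIdx<size {zero}  {zero} k<n _ = m≤n+m 1 (5 * n)
  spiroIdx<size {suc k} {zero} k+1<n _ rewrite spiroIdx-shared k+1<n =
    spiroIdx<size (<-trans (n<1+n k) k+1<n) (att<6 c k)

  hexagon-adj : ∀ {k r} → k < n → r < 6 → T (adj G (spiroIdx c k r) (spiroIdx c k (next r)))
  hexagon-adj k<n r<6 = Equivalence.from (adj⇔edge G) (inj₁ (hexEdges-∈ n (spiroIdx c) k<n r<6))

  cut-reach : ∀ {k} → suc k < n → Reaches G 0 (spiroIdx c k (att c k)) (spiroIdx c (suc k) 0)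
  cut-reach k+1<n rewrite spiroIdx-shared k+1<n = reach-refl _

  open ChainDistances G 0 n (att c) (att<6 c) (spiroIdx c)
                      (≤-trans (*-monoˡ-≤ n {3} {5} (s≤s (s≤s (s≤s z≤n)))) (m≤m+n (5 * n) 1))
                      spiroIdx<size hexagon-adj cut-reach potential potential-self potential-edge potential-pos public


  hexagon-sum : ∀ {k} → k < n →
    ∑[ i < 5 ] ∑[ u < suc (5 * k + i) ] dist G u (suc (5 * k + i)) ≡
    27 + ∑[ l < k ] (90 + 25 * transit 0 (att c) l (k ∸ suc l))
  hexagon-sum {k} k<n = begin
    ∑[ i < 5 ] ∑[ u < suc (5 * k + i) ] dist G u (suc (5 * k + i))
      ≡⟨ ∑-cong 5 (λ i i<5 → vertex-sum i<5) ⟩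
    ∑[ i < 5 ] (S + hexDist 0 (suc i) + (∑[ l < k ] ∑[ j < 5 ] across l j i + ∑[ j < i ] hexDist (suc j) (suc i)))
      ≡⟨ ∑-+ 5 (λ i → S + hexDist 0 (suc i))
               (λ i → ∑[ l < k ] ∑[ j < 5 ] across l j i + ∑[ j < i ] hexDist (suc j) (suc i)) ⟩
    ∑[ i < 5 ] (S + hexDist 0 (suc i)) + ∑[ i < 5 ] (∑[ l < k ] ∑[ j < 5 ] across l j i + ∑[ j < i ] hexDist (suc j) (suc i))
      ≡⟨ cong₂ _+_ (trans (∑-+ 5 (λ _ → S) (hexDist 0 ∘ suc)) (cong (_+ 9) (∑-const 5 S)))
                   (∑-+ 5 (λ i → ∑[ l < k ] ∑[ j < 5 ] across l j i) (λ i → ∑[ j < i ] hexDist (suc j) (suc i))) ⟩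
    5 * S + 9 + (∑[ i < 5 ] ∑[ l < k ] ∑[ j < 5 ] across l j i + 18)
      ≡⟨ cong (λ x → 5 * S + 9 + (x + 18)) (∑-comm 5 k (λ i l → ∑[ j < 5 ] across l j i)) ⟩
    5 * S + 9 + (B + 18)
      ≡⟨ lemma S B ⟩
    27 + (B + 5 * S)
      ≡⟨ cong (λ x → 27 + (B + x)) (∑-*ˡ k 5 (λ l → hexDist 0 (att c l) + 0)) ⟨
    27 + (B + ∑[ l < k ] (5 * (hexDist 0 (att c l) + 0)))
      ≡⟨ cong (27 +_) (∑-+ k (λ l → ∑[ i < 5 ] ∑[ j < 5 ] across l j i) (λ l → 5 * (hexDist 0 (att c l) + 0))) ⟨
    27 + ∑[ l < k ] (∑[ i < 5 ] ∑[ j < 5 ] across l j i + 5 * (hexDist 0 (att c l) + 0))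
      ≡⟨ cong (27 +_) (∑-cong k λ l _ → spiro-block (att<6 c l) (transit 0 (att c) l (k ∸ suc l))) ⟩
    27 + ∑[ l < k ] (90 + 25 * transit 0 (att c) l (k ∸ suc l))
      ∎
    where
    open ≡-Reasoning
    -- The distances from vertex 0 of the chain to the own vertices of hexagon k add up to
    -- 5 S + 9; the l-th summand of 5 S supplies the row entry of vertex 0 of hexagon l that
    -- block l lacks (see spiro-block).
    S : ℕ
    S = ∑[ l < k ] (hexDist 0 (att c l) + 0)
    across : ℕ → ℕ → ℕ → ℕ
    across l j i = hexDist (suc j) (att c l) + 0 + transit 0 (att c) l (k ∸ suc l) + hexDist 0 (suc i)
    B : ℕ
    B = ∑[ l < k ] ∑[ i < 5 ] ∑[ j < 5 ] across l j i
    lemma : ∀ S B → 5 * S + 9 + (B + 18) ≡ 27 + (B + 5 * S)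
    lemma = solve-∀
    vertex-sum : ∀ {i} → i < 5 → ∑[ u < suc (5 * k + i) ] dist G u (suc (5 * k + i)) ≡
      S + hexDist 0 (suc i) + (∑[ l < k ] ∑[ j < 5 ] across l j i + ∑[ j < i ] hexDist (suc j) (suc i))
    vertex-sum {i} i<5 = cong₂ _+_
      (trans (cong (dist G 0) (sym (spiroIdx-own k i))) (dist-from-start k<n (s≤s i<5)))
      (trans (∑-below-block 5 k i (λ u → dist G (suc u) (suc (5 * k + i)))) (cong₂ _+_
        (∑-cong k λ l l<k → ∑-cong 5 λ j j<5 →
          trans (cong₂ (dist G) (sym (spiroIdx-own l j)) (sym (spiroIdx-own k i))) (dist-across l<k k<n (s≤s j<5) (s≤s i<5)))
        (∑-cong i λ j j<i →
          trans (cong₂ (dist G) (sym (spiroIdx-own k j)) (sym (spiroIdx-own k i)))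
                (dist-within k<n (s≤s (<-trans j<i i<5)) (s≤s i<5)))))

  wiener-spiro : wiener G ≡ spiroBase n + 25 * innerPassages n (att c)
  wiener-spiro = begin
    wiener G                                        ≡⟨ wiener-∑ G ⟩
    ∑[ v < 5 * n + 1 ] ∑[ u < v ] dist G u v        ≡⟨ cong (λ m → ∑[ v < m ] ∑[ u < v ] dist G u v) (+-comm (5 * n) 1) ⟩
    ∑[ v < suc (5 * n) ] ∑[ u < v ] dist G u v      ≡⟨ ∑-blocks 5 n (λ w → ∑[ u < suc w ] dist G u (suc w)) ⟩
    ∑[ k < n ] ∑[ i < 5 ] ∑[ u < suc (5 * k + i) ] dist G u (suc (5 * k + i))
      ≡⟨ ∑-cong n (λ k k<n → hexagon-sum k<n) ⟩
    ∑[ k < n ] (27 + ∑[ l < k ] (90 + 25 * transit 0 (att c) l (k ∸ suc l)))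
      ≡⟨ ∑∑-linear n 27 (λ _ _ → 90) (λ k l → transit 0 (att c) l (k ∸ suc l)) 25 ⟩
    spiroBase n + 25 * innerPassages n (att c)      ∎
    where open ≡-Reasoning

-- Rankings by attained values

-- KthMin and KthMax are Ranked _<_ and Ranked (flip _<_).
Ranked : {A : Set} → (ℕ → ℕ → Set) → ℕ → (A → ℕ) → A → Set
Ranked {A} _≺_ k f a = Σ (List ℕ) λ vs → Unique vs × length vs ≡ k ×
  (∀ v → v ∈ vs → Σ A λ b → f b ≡ v × v ≺ f a) × (∀ b → f b ≺ f a → f b ∈ vs)

Unique-map⁺ : ∀ {xs} (h : ℕ → ℕ) → (∀ {x y} → x ∈ xs → y ∈ xs → h x ≡ h y → x ≡ y) →
              Unique xs → Unique (map h xs)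
Unique-map⁺ h inj [] = []
Unique-map⁺ h inj (x∉xs ∷ xs!) =
  All-map⁺ (All.tabulate λ y∈xs hx≡hy → All.lookup x∉xs y∈xs (inj (here refl) (there y∈xs) hx≡hy))
  ∷ Unique-map⁺ h (λ x∈ y∈ → inj (there x∈) (there y∈)) xs!

Ranked-transfer : ∀ {A : Set} {_≺_ : ℕ → ℕ → Set} {k} {f g : A → ℕ} (h : ℕ → ℕ) →
  (∀ b → h (f b) ≡ g b) → (∀ b b′ → g b ≡ g b′ → f b ≡ f b′) → (∀ a b → f b ≺ f a ⇔ g b ≺ g a) →
  ∀ {a} → Ranked _≺_ k f a → Ranked _≺_ k g a
Ranked-transfer {A} {_≺_} {f = f} {g} h h∘f≡g g-injective ≺⇔ {a} (vs , unique , length≡ , below , complete) =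
  map h vs , Unique-map⁺ h h-injective unique , trans (length-map h vs) length≡ , below′ , complete′
  where
  h-injective : ∀ {x y} → x ∈ vs → y ∈ vs → h x ≡ h y → x ≡ y
  h-injective x∈ y∈ hx≡hy with below _ x∈ | below _ y∈
  ... | b , refl , _ | b′ , refl , _ = g-injective b b′ (trans (sym (h∘f≡g b)) (trans hx≡hy (h∘f≡g b′)))
  below′ : ∀ v → v ∈ map h vs → Σ A λ b → g b ≡ v × v ≺ g a
  below′ v v∈ with ∈-map⁻ h v∈
  ... | w , w∈ , refl with below w w∈
  ... | b , refl , fb≺fa = b , sym (h∘f≡g b) , subst (_≺ g a) (sym (h∘f≡g b)) (Equivalence.to (≺⇔ a b) fb≺fa)
  complete′ : ∀ b → g b ≺ g a → g b ∈ map h vs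
  complete′ b gb≺ga = subst (_∈ map h vs) (h∘f≡g b) (∈-map⁺ h (complete b (Equivalence.from (≺⇔ a b) gb≺ga)))

<-affine : ∀ P p {x y} → x < y ⇔ P + suc p * x < P + suc p * y
<-affine P p {x} {y} = mk⇔ (λ x<y → +-monoʳ-< P (*-monoʳ-< (suc p) x<y))
                          (λ lt → *-cancelˡ-< (suc p) x y (+-cancelˡ-< P _ _ lt))

Ranked-affine : ∀ {A : Set} {_≺_ : ℕ → ℕ → Set} →
  (∀ P p {x y} → x ≺ y ⇔ (P + suc p * x) ≺ (P + suc p * y)) →
  ∀ {score f g : A → ℕ} {P p Q q} → (∀ b → f b ≡ P + suc p * score b) → (∀ b → g b ≡ Q + suc q * score b) →
  ∀ {k a} → Ranked _≺_ k f a → Ranked _≺_ k g a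
Ranked-affine {_≺_ = _≺_} ≺-affine {score} {f} {g} {P} {p} {Q} {q} f≡ g≡ =
  Ranked-transfer {_≺_ = _≺_} {f = f} {g} (λ v → Q + suc q * ((v ∸ P) / suc p)) h∘f≡g g-injective ≺⇔
  where
  score-from-f : ∀ b → (f b ∸ P) / suc p ≡ score b
  score-from-f b = begin
    (f b ∸ P) / suc p        ≡⟨ /-congˡ (trans (cong (_∸ P) (f≡ b)) (m+n∸m≡n P _)) ⟩
    suc p * score b / suc p  ≡⟨ /-congˡ (*-comm (suc p) (score b)) ⟩
    score b * suc p / suc p  ≡⟨ m*n/n≡m (score b) (suc p) ⟩
    score b                  ∎
    where open ≡-Reasoning
  h∘f≡g : ∀ b → Q + suc q * ((f b ∸ P) / suc p) ≡ g b
  h∘f≡g b = trans (cong (λ x → Q + suc q * x) (score-from-f b)) (sym (g≡ b))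
  g-injective : ∀ b b′ → g b ≡ g b′ → f b ≡ f b′
  g-injective b b′ gb≡gb′ = begin
    f b                   ≡⟨ f≡ b ⟩
    P + suc p * score b   ≡⟨ cong (λ x → P + suc p * x) score≡ ⟩
    P + suc p * score b′  ≡⟨ f≡ b′ ⟨
    f b′                  ∎
    where
    open ≡-Reasoning
    score≡ : score b ≡ score b′
    score≡ = *-cancelˡ-≡ (score b) (score b′) (suc q)
               (+-cancelˡ-≡ Q _ _ (trans (sym (g≡ b)) (trans gb≡gb′ (g≡ b′))))
  ≺⇔ : ∀ a b → f b ≺ f a ⇔ g b ≺ g a
  ≺⇔ a b = mk⇔
    (λ fb≺fa → subst₂ _≺_ (sym (g≡ b)) (sym (g≡ a))
                 (Equivalence.to (≺-affine Q q) (Equivalence.from (≺-affine P p) (subst₂ _≺_ (f≡ b) (f≡ a) fb≺fa))))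
    (λ gb≺ga → subst₂ _≺_ (sym (f≡ b)) (sym (f≡ a))
                 (Equivalence.to (≺-affine P p) (Equivalence.from (≺-affine Q q) (subst₂ _≺_ (g≡ b) (g≡ a) gb≺ga))))

theorem4p2 : (n : ℕ) → 4 ≤ n → (c : Code n) → (k : ℕ) → k < 3 →
    (KthMin k (λ x → wiener (polyphenyl n x)) c ⇔ KthMin k (λ x → wiener (spiro n x)) c)
    × (KthMax k (λ x → wiener (polyphenyl n x)) c ⇔ KthMax k (λ x → wiener (spiro n x)) c)
theorem4p2 n _ c k _ = transfer <-affine , transfer (λ P p {x} {y} → <-affine P p {y} {x})
  where
  score : Code n → ℕ
  score b = innerPassages n (att b)
  transfer : ∀ {_≺_ : ℕ → ℕ → Set} → (∀ P p {x y} → x ≺ y ⇔ (P + suc p * x) ≺ (P + suc p * y)) →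
    Ranked _≺_ k (λ x → wiener (polyphenyl n x)) c ⇔ Ranked _≺_ k (λ x → wiener (spiro n x)) c
  transfer ≺-affine = mk⇔
    (Ranked-affine ≺-affine {score = score} {P = polyphenylBase n} {p = 35} {Q = spiroBase n} {q = 24}
                   (Polyphenyl.wiener-polyphenyl n) (Spiro.wiener-spiro n))
    (Ranked-affine ≺-affine {score = score} {P = spiroBase n} {p = 24} {Q = polyphenylBase n} {q = 35}
                   (Spiro.wiener-spiro n) (Polyphenyl.wiener-polyphenyl n))
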